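{- Let $K$ be a number field, $s=2$, $\alpha_1=0$ and $\alpha_2=\alpha\in K\setminus\{0\}$. For every $n\in\mathbb{N}_+$, \[ A_{n,n}=\begin{pmatrix}P_{n-1,n}(0)&P_{n-1,n}(\alpha)\\ P_{n,n-1}(0)&P_{n,n-1}(\alpha)\end{pmatrix}=(n-1)!\,C_nC_{n-1}\cdots C_1, \qquad C_i=\begin{pmatrix}2i-1-\alpha&2i-1\\2i-1&2i-1+\alpha\end{pmatrix}\ (i\in\mathbb{N}_+). \]
   Context: For $(m_1,m_2)\in\mathbb{N}^2$ with $M=m_1+m_2$: $f_{m_1,m_2}(z)=z^{m_1}(z-\alpha)^{m_2}$ and $P_{m_1,m_2}(z)=\sum_{k=0}^{M}f_{m_1,m_2}^{(k)}(z)$. For $(n_1,n_2)\in\mathbb{N}_+^2$, $A_{n_1,n_2}$ is the $2\times2$ matrix with rows $(P_{n_1-1,n_2}(0),P_{n_1-1,n_2}(\alpha))$ and $(P_{n_1,n_2-1}(0),P_{n_1,n_2-1}(\alpha))$. -}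

module Defs where

open import Level using (Level)
open import Algebra.Bundles using (CommutativeRing)
open import Data.Nat using (ℕ; zero; suc; _∸_) renaming (_*_ to _*ℕ_; _+_ to _+ℕ_)
open import Data.Fin using (Fin; zero; suc)
open import Data.List using (List; []; _∷_)

-- Everything is parametrised by a commutative ring R (the paper's K) and
-- a scalar α ∈ R.
module Poly {c ℓ : Level} (R : CommutativeRing c ℓ) where
  open CommutativeRing R using (Carrier; _+_; _*_; -_; _-_; 0#; 1#)

  natR : ℕ → Carrier
  natR zero    = 0#
  natR (suc n) = 1# + natR n

  -- polynomials over R as coefficient lists, lowest degree first
  Pol : Set c
  Pol = List Carrier

  _⊕_ : Pol → Pol → Pol
  []       ⊕ q        = q
  (a ∷ p)  ⊕ []       = a ∷ p
  (a ∷ p)  ⊕ (b ∷ q)  = (a + b) ∷ (p ⊕ q)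

  scale : Carrier → Pol → Pol
  scale c []      = []
  scale c (a ∷ p) = (c * a) ∷ scale c p

  _⊗_ : Pol → Pol → Pol
  []      ⊗ q = []
  (a ∷ p) ⊗ q = scale a q ⊕ (0# ∷ (p ⊗ q))

  _^P_ : Pol → ℕ → Pol
  p ^P zero  = 1# ∷ []
  p ^P suc n = p ⊗ (p ^P n)

  derivFrom : ℕ → Pol → Pol
  derivFrom k []      = []
  derivFrom k (a ∷ p) = (natR k * a) ∷ derivFrom (suc k) p

  deriv : Pol → Pol
  deriv []      = []
  deriv (a ∷ p) = derivFrom 1 p

  derivN : ℕ → Pol → Pol
  derivN zero    p = p
  derivN (suc k) p = deriv (derivN k p)

  eval : Pol → Carrier → Carrier
  eval []      z = 0#
  eval (a ∷ p) z = a + z * eval p z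

  module WithAlpha (α : Carrier) where
    -- f_{m1,m2}(z) = z^{m1} (z - α)^{m2}
    f : ℕ → ℕ → Pol
    f m₁ m₂ = ((0# ∷ 1# ∷ []) ^P m₁) ⊗ (((- α) ∷ 1# ∷ []) ^P m₂)

    sumDerivs : ℕ → Pol → Carrier → Carrier
    sumDerivs zero    p z = eval p z
    sumDerivs (suc k) p z = eval (derivN (suc k) p) z + sumDerivs k p z

    P : ℕ → ℕ → Carrier → Carrier
    P m₁ m₂ z = sumDerivs (m₁ +ℕ m₂) (f m₁ m₂) z

    Mat : Set c
    Mat = Fin 2 → Fin 2 → Carrier

    mk : Carrier → Carrier → Carrier → Carrier → Mat
    mk a b c' d zero       zero       = a
    mk a b c' d zero       (suc zero) = b
    mk a b c' d (suc zero) zero       = c'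
    mk a b c' d (suc zero) (suc zero) = d

    _⊛_ : Mat → Mat → Mat
    (X ⊛ Y) i j = X i zero * Y zero j + X i (suc zero) * Y (suc zero) j

    I₂ : Mat
    I₂ = mk 1# 0# 0# 1#

    -- A_{n1,n2} (meaningful for n1, n2 ≥ 1)
    A : ℕ → ℕ → Mat
    A n₁ n₂ = mk (P (n₁ ∸ 1) n₂ 0#) (P (n₁ ∸ 1) n₂ α)
                 (P n₁ (n₂ ∸ 1) 0#) (P n₁ (n₂ ∸ 1) α)

    -- C_i = ((2i-1-α, 2i-1), (2i-1, 2i-1+α))  (meaningful for i ≥ 1)
    C : ℕ → Mat
    C i = mk (natR (2 *ℕ i ∸ 1) - α) (natR (2 *ℕ i ∸ 1))
             (natR (2 *ℕ i ∸ 1)) (natR (2 *ℕ i ∸ 1) + α)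

    prodC : ℕ → Mat
    prodC zero    = I₂
    prodC (suc n) = C (suc n) ⊛ prodC n

{-# OPTIONS --safe #-}
-- Since f_{m₁+1,m₂+1} vanishes at 0 and at α, and its derivative is
-- (m₁+1) f_{m₁,m₂+1} + (m₂+1) f_{m₁+1,m₂}, at these two points
--   P_{m₁+1,m₂+1} = (m₁+1) P_{m₁,m₂+1} + (m₂+1) P_{m₁+1,m₂}.
-- Writing z = (z − α) + α gives f_{m₁+1,m₂} = f_{m₁,m₂+1} + α f_{m₁,m₂}, and since the
-- (m₁+m₂+1)-st derivative of f_{m₁,m₂} vanishes this becomes
--   P_{m₁+1,m₂} = P_{m₁,m₂+1} + α P_{m₁,m₂}.
-- Eliminating P_{n,n+2} and P_{n+2,n} between the two relations turns them into the matrix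
-- identity A_{n+2,n+2} = (n+1) C_{n+2} A_{n+1,n+1}; together with A_{1,1} = C_1, induction on n
-- gives the product formula.
module Submission where

open import Defs
open import Level using (Level)
open import Algebra.Bundles using (CommutativeRing; CommutativeSemigroup)
open import Data.Nat using (ℕ; zero; suc; _!)
open import Data.Fin using (Fin; zero; suc)
open import Relation.Nullary using (¬_)

import Data.Nat as ℕ
import Data.Nat.Properties as ℕ
open import Data.List using ([]; _∷_; length)
open import Relation.Binary.PropositionalEquality as ≡ using (_≡_)
open import Relation.Binary.Bundles using (Setoid)
open import Relation.Binary.Structures using (IsEquivalence)
import Algebra.Properties.CommutativeSemigroup

module _ {c ℓ : Level} (R : CommutativeRing c ℓ) where

  open CommutativeRing R hiding (zero)
  open Poly R
  -- Natural-number coefficients suffice: negation only ever enters the identities below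
  -- through the atom - α.
  open import Algebra.Solver.Ring.NaturalCoefficients.Default commutativeSemiring
    using (solve; _:=_; _:+_; _:*_; con)

  module _ where
    open import Relation.Binary.Reasoning.Setoid setoid

    natR-+ : ∀ m n → natR (m ℕ.+ n) ≈ natR m + natR n
    natR-+ zero    n = sym (+-identityˡ _)
    natR-+ (suc m) n = trans (+-congˡ (natR-+ m n)) (sym (+-assoc _ _ _))

    natR-* : ∀ m n → natR (m ℕ.* n) ≈ natR m * natR n
    natR-* zero    n = sym (zeroˡ _)
    natR-* (suc m) n = begin
      natR (n ℕ.+ m ℕ.* n)      ≈⟨ natR-+ n (m ℕ.* n) ⟩
      natR n + natR (m ℕ.* n)   ≈⟨ +-congˡ (natR-* m n) ⟩
      natR n + natR m * natR n  ≈⟨ solve 2 (λ x y → x :+ y :* x := (con 1 :+ y) :* x) refl (natR n) (natR m) ⟩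
      (1# + natR m) * natR n    ∎

    natR-2*-∸1 : ∀ m → natR (2 ℕ.* suc m ℕ.∸ 1) ≈ natR m + natR (suc m)
    natR-2*-∸1 m = begin
      natR (m ℕ.+ suc (m ℕ.+ 0))     ≈⟨ natR-+ m (suc (m ℕ.+ 0)) ⟩
      natR m + natR (suc (m ℕ.+ 0))  ≡⟨ ≡.cong (λ k → natR m + natR (suc k)) (ℕ.+-identityʳ m) ⟩
      natR m + natR (suc m)          ∎

    -- Polynomials up to equality of coefficients

    -- Coefficient lists differing by trailing zeros represent the same polynomial.
    coeff : ℕ → Pol → Carrier
    coeff i       []      = 0#
    coeff zero    (a ∷ p) = a
    coeff (suc i) (a ∷ p) = coeff i p

    infix 4 _≋_
    record _≋_ (p q : Pol) : Set ℓ where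
      constructor mk≋
      field at : ∀ i → coeff i p ≈ coeff i q
    open _≋_ public

    ≋-isEquivalence : IsEquivalence _≋_
    ≋-isEquivalence = record
      { refl  = mk≋ λ _ → refl
      ; sym   = λ e → mk≋ λ i → sym (at e i)
      ; trans = λ e e′ → mk≋ λ i → trans (at e i) (at e′ i)
      }

    open IsEquivalence ≋-isEquivalence public
      using () renaming (refl to ≋-refl; sym to ≋-sym; trans to ≋-trans)

    ≋-setoid : Setoid c ℓ
    ≋-setoid = record { isEquivalence = ≋-isEquivalence }

    ∷-cong : ∀ {a b p q} → a ≈ b → p ≋ q → a ∷ p ≋ b ∷ q
    ∷-cong a≈b p≋q = mk≋ λ { zero → a≈b ; (suc i) → at p≋q i }

    0∷[]≋[] : 0# ∷ [] ≋ []
    0∷[]≋[] = mk≋ λ { zero → refl ; (suc i) → refl }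

    coeff-⊕ : ∀ p q i → coeff i (p ⊕ q) ≈ coeff i p + coeff i q
    coeff-⊕ []      q       i       = sym (+-identityˡ _)
    coeff-⊕ (a ∷ p) []      i       = sym (+-identityʳ _)
    coeff-⊕ (a ∷ p) (b ∷ q) zero    = refl
    coeff-⊕ (a ∷ p) (b ∷ q) (suc i) = coeff-⊕ p q i

    coeff-scale : ∀ a p i → coeff i (scale a p) ≈ a * coeff i p
    coeff-scale a []      i       = sym (zeroʳ a)
    coeff-scale a (b ∷ p) zero    = refl
    coeff-scale a (b ∷ p) (suc i) = coeff-scale a p i

    ⊕-cong : ∀ {p p′ q q′} → p ≋ p′ → q ≋ q′ → p ⊕ q ≋ p′ ⊕ q′
    ⊕-cong {p} {p′} {q} {q′} p≋p′ q≋q′ = mk≋ λ i → begin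
      coeff i (p ⊕ q)             ≈⟨ coeff-⊕ p q i ⟩
      coeff i p + coeff i q       ≈⟨ +-cong (at p≋p′ i) (at q≋q′ i) ⟩
      coeff i p′ + coeff i q′     ≈⟨ coeff-⊕ p′ q′ i ⟨
      coeff i (p′ ⊕ q′)           ∎

    ⊕-assoc : ∀ p q r → (p ⊕ q) ⊕ r ≋ p ⊕ (q ⊕ r)
    ⊕-assoc p q r = mk≋ λ i → begin
      coeff i ((p ⊕ q) ⊕ r)                ≈⟨ trans (coeff-⊕ (p ⊕ q) r i) (+-congʳ (coeff-⊕ p q i)) ⟩
      (coeff i p + coeff i q) + coeff i r  ≈⟨ +-assoc _ _ _ ⟩
      coeff i p + (coeff i q + coeff i r)  ≈⟨ trans (coeff-⊕ p (q ⊕ r) i) (+-congˡ (coeff-⊕ q r i)) ⟨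
      coeff i (p ⊕ (q ⊕ r))                ∎

    ⊕-comm : ∀ p q → p ⊕ q ≋ q ⊕ p
    ⊕-comm p q = mk≋ λ i → trans (coeff-⊕ p q i) (trans (+-comm _ _) (sym (coeff-⊕ q p i)))

    ⊕-congˡ : ∀ p {q q′} → q ≋ q′ → p ⊕ q ≋ p ⊕ q′
    ⊕-congˡ p = ⊕-cong ≋-refl

    ⊕-congʳ : ∀ {p p′} q → p ≋ p′ → p ⊕ q ≋ p′ ⊕ q
    ⊕-congʳ q p≋p′ = ⊕-cong p≋p′ ≋-refl

    ⊕-identityʳ : ∀ p → p ⊕ [] ≋ p
    ⊕-identityʳ p = mk≋ λ i → trans (coeff-⊕ p [] i) (+-identityʳ _)

    0∷-⊕ : ∀ p q → 0# ∷ (p ⊕ q) ≋ (0# ∷ p) ⊕ (0# ∷ q)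
    0∷-⊕ p q = ∷-cong (sym (+-identityʳ 0#)) ≋-refl

    scale-congˡ : ∀ {a b} p → a ≈ b → scale a p ≋ scale b p
    scale-congˡ {a} {b} p a≈b = mk≋ λ i → trans (coeff-scale a p i) (trans (*-congʳ a≈b) (sym (coeff-scale b p i)))

    scale-congʳ : ∀ a {p q} → p ≋ q → scale a p ≋ scale a q
    scale-congʳ a {p} {q} p≋q = mk≋ λ i → trans (coeff-scale a p i) (trans (*-congˡ (at p≋q i)) (sym (coeff-scale a q i)))

    scale-zero : ∀ p → scale 0# p ≋ []
    scale-zero p = mk≋ λ i → trans (coeff-scale 0# p i) (zeroˡ _)

    scale-identity : ∀ p → scale 1# p ≋ p
    scale-identity p = mk≋ λ i → trans (coeff-scale 1# p i) (*-identityˡ _)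

    scale-scale : ∀ a b p → scale a (scale b p) ≋ scale (a * b) p
    scale-scale a b p = mk≋ λ i → begin
      coeff i (scale a (scale b p))  ≈⟨ trans (coeff-scale a (scale b p) i) (*-congˡ (coeff-scale b p i)) ⟩
      a * (b * coeff i p)            ≈⟨ *-assoc a b _ ⟨
      (a * b) * coeff i p            ≈⟨ coeff-scale (a * b) p i ⟨
      coeff i (scale (a * b) p)      ∎

    scale-distribʳ : ∀ a b p → scale (a + b) p ≋ scale a p ⊕ scale b p
    scale-distribʳ a b p = mk≋ λ i → begin
      coeff i (scale (a + b) p)          ≈⟨ coeff-scale (a + b) p i ⟩
      (a + b) * coeff i p                ≈⟨ distribʳ _ a b ⟩
      a * coeff i p + b * coeff i p      ≈⟨ +-cong (coeff-scale a p i) (coeff-scale b p i) ⟨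
      coeff i (scale a p) + coeff i (scale b p)  ≈⟨ coeff-⊕ (scale a p) (scale b p) i ⟨
      coeff i (scale a p ⊕ scale b p)    ∎

    scale-distribˡ : ∀ a p q → scale a (p ⊕ q) ≋ scale a p ⊕ scale a q
    scale-distribˡ a p q = mk≋ λ i → begin
      coeff i (scale a (p ⊕ q))          ≈⟨ trans (coeff-scale a (p ⊕ q) i) (*-congˡ (coeff-⊕ p q i)) ⟩
      a * (coeff i p + coeff i q)        ≈⟨ distribˡ a _ _ ⟩
      a * coeff i p + a * coeff i q      ≈⟨ +-cong (coeff-scale a p i) (coeff-scale a q i) ⟨
      coeff i (scale a p) + coeff i (scale a q)  ≈⟨ coeff-⊕ (scale a p) (scale a q) i ⟨
      coeff i (scale a p ⊕ scale a q)    ∎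

    coeff-derivFrom : ∀ k p i → coeff i (derivFrom k p) ≈ natR (k ℕ.+ i) * coeff i p
    coeff-derivFrom k []      i       = sym (zeroʳ _)
    coeff-derivFrom k (a ∷ p) zero    = *-congʳ (reflexive (≡.cong natR (≡.sym (ℕ.+-identityʳ k))))
    coeff-derivFrom k (a ∷ p) (suc i) = trans (coeff-derivFrom (suc k) p i)
                                              (*-congʳ (reflexive (≡.cong natR (≡.sym (ℕ.+-suc k i)))))

    coeff-deriv : ∀ p i → coeff i (deriv p) ≈ natR (suc i) * coeff (suc i) p
    coeff-deriv []      i = sym (zeroʳ _)
    coeff-deriv (a ∷ p) i = coeff-derivFrom 1 p i

    deriv-cong : ∀ {p q} → p ≋ q → deriv p ≋ deriv q
    deriv-cong {p} {q} p≋q = mk≋ λ i → trans (coeff-deriv p i) (trans (*-congˡ (at p≋q (suc i))) (sym (coeff-deriv q i)))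

    deriv-⊕ : ∀ p q → deriv (p ⊕ q) ≋ deriv p ⊕ deriv q
    deriv-⊕ p q = mk≋ λ i → begin
      coeff i (deriv (p ⊕ q))                            ≈⟨ trans (coeff-deriv (p ⊕ q) i) (*-congˡ (coeff-⊕ p q (suc i))) ⟩
      natR (suc i) * (coeff (suc i) p + coeff (suc i) q)  ≈⟨ distribˡ _ _ _ ⟩
      natR (suc i) * coeff (suc i) p + natR (suc i) * coeff (suc i) q
                                                         ≈⟨ +-cong (coeff-deriv p i) (coeff-deriv q i) ⟨
      coeff i (deriv p) + coeff i (deriv q)              ≈⟨ coeff-⊕ (deriv p) (deriv q) i ⟨
      coeff i (deriv p ⊕ deriv q)                        ∎

    deriv-scale : ∀ a p → deriv (scale a p) ≋ scale a (deriv p)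
    deriv-scale a p = mk≋ λ i → begin
      coeff i (deriv (scale a p))           ≈⟨ trans (coeff-deriv (scale a p) i) (*-congˡ (coeff-scale a p (suc i))) ⟩
      natR (suc i) * (a * coeff (suc i) p)  ≈⟨ solve 3 (λ n a x → n :* (a :* x) := a :* (n :* x)) refl (natR (suc i)) a _ ⟩
      a * (natR (suc i) * coeff (suc i) p)  ≈⟨ trans (coeff-scale a (deriv p) i) (*-congˡ (coeff-deriv p i)) ⟨
      coeff i (scale a (deriv p))           ∎

    -- a ∷ p is a + z p, so this is the product rule for z p.
    deriv-∷ : ∀ a p → deriv (a ∷ p) ≋ p ⊕ (0# ∷ deriv p)
    deriv-∷ a p = mk≋ λ where
      zero → begin
          coeff 0 (derivFrom 1 p)  ≈⟨ coeff-derivFrom 1 p 0 ⟩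
          (1# + 0#) * coeff 0 p    ≈⟨ solve 1 (λ x → (con 1 :+ con 0) :* x := x :+ con 0) refl _ ⟩
          coeff 0 p + 0#           ≈⟨ coeff-⊕ p (0# ∷ deriv p) 0 ⟨
          coeff 0 (p ⊕ (0# ∷ deriv p)) ∎
      (suc i) → begin
          coeff (suc i) (derivFrom 1 p)                      ≈⟨ coeff-derivFrom 1 p (suc i) ⟩
          (1# + natR (suc i)) * coeff (suc i) p              ≈⟨ solve 2 (λ n x → (con 1 :+ n) :* x := x :+ n :* x) refl _ _ ⟩
          coeff (suc i) p + natR (suc i) * coeff (suc i) p   ≈⟨ +-congˡ (coeff-deriv p i) ⟨
          coeff (suc i) p + coeff i (deriv p)                ≈⟨ coeff-⊕ p (0# ∷ deriv p) (suc i) ⟨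
          coeff (suc i) (p ⊕ (0# ∷ deriv p))                 ∎

    eval-zero : ∀ p z → p ≋ [] → eval p z ≈ 0#
    eval-zero []      z p≋[] = refl
    eval-zero (a ∷ p) z p≋[] = begin
      a + z * eval p z  ≈⟨ +-cong (at p≋[] 0) (*-congˡ (eval-zero p z (mk≋ λ i → at p≋[] (suc i)))) ⟩
      0# + z * 0#       ≈⟨ trans (+-identityˡ _) (zeroʳ z) ⟩
      0#                ∎

    eval-cong : ∀ {p q} z → p ≋ q → eval p z ≈ eval q z
    eval-cong {[]}    {q}     z p≋q = sym (eval-zero q z (≋-sym p≋q))
    eval-cong {a ∷ p} {[]}    z p≋q = eval-zero (a ∷ p) z p≋q
    eval-cong {a ∷ p} {b ∷ q} z p≋q = +-cong (at p≋q 0) (*-congˡ (eval-cong {p} {q} z (mk≋ λ i → at p≋q (suc i))))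

    eval-⊕ : ∀ p q z → eval (p ⊕ q) z ≈ eval p z + eval q z
    eval-⊕ []      q       z = sym (+-identityˡ _)
    eval-⊕ (a ∷ p) []      z = sym (+-identityʳ _)
    eval-⊕ (a ∷ p) (b ∷ q) z = begin
      (a + b) + z * eval (p ⊕ q) z         ≈⟨ +-congˡ (*-congˡ (eval-⊕ p q z)) ⟩
      (a + b) + z * (eval p z + eval q z)
        ≈⟨ solve 5 (λ a b z x y → (a :+ b) :+ z :* (x :+ y) := (a :+ z :* x) :+ (b :+ z :* y)) refl a b z _ _ ⟩
      (a + z * eval p z) + (b + z * eval q z) ∎

    eval-scale : ∀ a p z → eval (scale a p) z ≈ a * eval p z
    eval-scale a []      z = sym (zeroʳ _)
    eval-scale a (b ∷ p) z = begin
      a * b + z * eval (scale a p) z  ≈⟨ +-congˡ (*-congˡ (eval-scale a p z)) ⟩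
      a * b + z * (a * eval p z)      ≈⟨ solve 4 (λ a b z x → a :* b :+ z :* (a :* x) := a :* (b :+ z :* x)) refl a b z _ ⟩
      a * (b + z * eval p z)          ∎

  ⊕-commutativeSemigroup : CommutativeSemigroup c ℓ
  ⊕-commutativeSemigroup = record
    { _≈_ = _≋_
    ; _∙_ = _⊕_
    ; isCommutativeSemigroup = record
      { isSemigroup = record
        { isMagma = record { isEquivalence = ≋-isEquivalence ; ∙-cong = ⊕-cong }
        ; assoc   = ⊕-assoc
        }
      ; comm = ⊕-comm
      }
    }

  private
    module ⊕-Properties = Algebra.Properties.CommutativeSemigroup ⊕-commutativeSemigroup
    module +-Properties = Algebra.Properties.CommutativeSemigroup +-commutativeSemigroup

  -- Multiplication and the product rule

  module _ where
    open import Relation.Binary.Reasoning.Setoid ≋-setoid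

    const-⊗ : ∀ a p → (a ∷ []) ⊗ p ≋ scale a p
    const-⊗ a p = ≋-trans (⊕-congˡ (scale a p) 0∷[]≋[]) (⊕-identityʳ (scale a p))

    ⊗-zeroʳ : ∀ p → p ⊗ [] ≋ []
    ⊗-zeroʳ []      = ≋-refl
    ⊗-zeroʳ (a ∷ p) = ≋-trans (∷-cong refl (⊗-zeroʳ p)) 0∷[]≋[]

    ⊗-zeroˡ : ∀ {p} q → p ≋ [] → p ⊗ q ≋ []
    ⊗-zeroˡ {[]}    q p≋[] = ≋-refl
    ⊗-zeroˡ {a ∷ p} q p≋[] = begin
      scale a q ⊕ (0# ∷ p ⊗ q)  ≈⟨ ⊕-cong (≋-trans (scale-congˡ q (at p≋[] 0)) (scale-zero q))
                                          (∷-cong refl (⊗-zeroˡ {p} q (mk≋ λ i → at p≋[] (suc i)))) ⟩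
      0# ∷ []                   ≈⟨ 0∷[]≋[] ⟩
      []                        ∎

    ⊗-congˡ : ∀ {p p′} q → p ≋ p′ → p ⊗ q ≋ p′ ⊗ q
    ⊗-congˡ {[]}    {p′}     q p≋p′ = ≋-sym (⊗-zeroˡ {p′} q (≋-sym p≋p′))
    ⊗-congˡ {a ∷ p} {[]}     q p≋p′ = ⊗-zeroˡ {a ∷ p} q p≋p′
    ⊗-congˡ {a ∷ p} {a′ ∷ p′} q p≋p′ =
      ⊕-cong (scale-congˡ q (at p≋p′ 0)) (∷-cong refl (⊗-congˡ {p} {p′} q (mk≋ λ i → at p≋p′ (suc i))))

    0∷-⊗ : ∀ p q → (0# ∷ p) ⊗ q ≋ 0# ∷ p ⊗ q
    0∷-⊗ p q = ⊕-congʳ (0# ∷ p ⊗ q) (scale-zero q)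

    ⊗-distribʳ-⊕ : ∀ p p′ q → (p ⊕ p′) ⊗ q ≋ (p ⊗ q) ⊕ (p′ ⊗ q)
    ⊗-distribʳ-⊕ []      p′       q = ≋-refl
    ⊗-distribʳ-⊕ (a ∷ p) []       q = ≋-sym (⊕-identityʳ _)
    ⊗-distribʳ-⊕ (a ∷ p) (b ∷ p′) q = begin
      scale (a + b) q ⊕ (0# ∷ (p ⊕ p′) ⊗ q)
        ≈⟨ ⊕-cong (scale-distribʳ a b q) (∷-cong refl (⊗-distribʳ-⊕ p p′ q)) ⟩
      (scale a q ⊕ scale b q) ⊕ (0# ∷ ((p ⊗ q) ⊕ (p′ ⊗ q)))
        ≈⟨ ⊕-congˡ (scale a q ⊕ scale b q) (0∷-⊕ (p ⊗ q) (p′ ⊗ q)) ⟩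
      (scale a q ⊕ scale b q) ⊕ ((0# ∷ p ⊗ q) ⊕ (0# ∷ p′ ⊗ q))
        ≈⟨ ⊕-Properties.interchange (scale a q) (scale b q) (0# ∷ p ⊗ q) (0# ∷ p′ ⊗ q) ⟩
      (scale a q ⊕ (0# ∷ p ⊗ q)) ⊕ (scale b q ⊕ (0# ∷ p′ ⊗ q)) ∎

    ⊗-scaleˡ : ∀ a p q → scale a p ⊗ q ≋ scale a (p ⊗ q)
    ⊗-scaleˡ a []      q = ≋-refl
    ⊗-scaleˡ a (b ∷ p) q = begin
      scale (a * b) q ⊕ (0# ∷ scale a p ⊗ q)
        ≈⟨ ⊕-cong (≋-sym (scale-scale a b q)) (∷-cong (sym (zeroʳ a)) (⊗-scaleˡ a p q)) ⟩
      scale a (scale b q) ⊕ scale a (0# ∷ p ⊗ q)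
        ≈⟨ scale-distribˡ a (scale b q) (0# ∷ p ⊗ q) ⟨
      scale a (scale b q ⊕ (0# ∷ p ⊗ q)) ∎

    ⊗-assoc : ∀ p q r → (p ⊗ q) ⊗ r ≋ p ⊗ (q ⊗ r)
    ⊗-assoc []      q r = ≋-refl
    ⊗-assoc (a ∷ p) q r = begin
      (scale a q ⊕ (0# ∷ p ⊗ q)) ⊗ r               ≈⟨ ⊗-distribʳ-⊕ (scale a q) (0# ∷ p ⊗ q) r ⟩
      (scale a q ⊗ r) ⊕ ((0# ∷ p ⊗ q) ⊗ r)          ≈⟨ ⊕-cong (⊗-scaleˡ a q r) (0∷-⊗ (p ⊗ q) r) ⟩
      scale a (q ⊗ r) ⊕ (0# ∷ (p ⊗ q) ⊗ r)          ≈⟨ ⊕-congˡ (scale a (q ⊗ r)) (∷-cong refl (⊗-assoc p q r)) ⟩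
      scale a (q ⊗ r) ⊕ (0# ∷ p ⊗ (q ⊗ r))          ∎

    ⊗-∷ʳ : ∀ p a q → p ⊗ (a ∷ q) ≋ scale a p ⊕ (0# ∷ p ⊗ q)
    ⊗-∷ʳ []      a q = ≋-sym 0∷[]≋[]
    ⊗-∷ʳ (b ∷ p) a q = begin
      (b * a + 0#) ∷ (scale b q ⊕ (p ⊗ (a ∷ q)))
        ≈⟨ ∷-cong (trans (+-identityʳ _) (*-comm b a)) (⊕-congˡ (scale b q) (⊗-∷ʳ p a q)) ⟩
      a * b ∷ (scale b q ⊕ (scale a p ⊕ (0# ∷ p ⊗ q)))
        ≈⟨ ∷-cong (sym (+-identityʳ _)) (⊕-Properties.x∙yz≈y∙xz (scale b q) (scale a p) (0# ∷ p ⊗ q)) ⟩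
      (a * b + 0#) ∷ (scale a p ⊕ (scale b q ⊕ (0# ∷ p ⊗ q))) ∎

    ⊗-comm : ∀ p q → p ⊗ q ≋ q ⊗ p
    ⊗-comm []      q = ≋-sym (⊗-zeroʳ q)
    ⊗-comm (a ∷ p) q = ≋-trans (⊕-congˡ (scale a q) (∷-cong refl (⊗-comm p q))) (≋-sym (⊗-∷ʳ q a p))

    ⊗-congʳ : ∀ p {q q′} → q ≋ q′ → p ⊗ q ≋ p ⊗ q′
    ⊗-congʳ p {q} {q′} q≋q′ = ≋-trans (⊗-comm p q) (≋-trans (⊗-congˡ p q≋q′) (⊗-comm q′ p))

    ⊗-scaleʳ : ∀ a p q → p ⊗ scale a q ≋ scale a (p ⊗ q)
    ⊗-scaleʳ a p q = ≋-trans (⊗-comm p (scale a q)) (≋-trans (⊗-scaleˡ a q p) (scale-congʳ a (⊗-comm q p)))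

    ⊗-identityʳ : ∀ p → p ⊗ (1# ∷ []) ≋ p
    ⊗-identityʳ p = ≋-trans (⊗-comm p (1# ∷ [])) (≋-trans (const-⊗ 1# p) (scale-identity p))

    deriv-⊗ : ∀ p q → deriv (p ⊗ q) ≋ (deriv p ⊗ q) ⊕ (p ⊗ deriv q)
    deriv-⊗ []      q = ≋-refl
    deriv-⊗ (a ∷ p) q = begin
      deriv (scale a q ⊕ (0# ∷ p ⊗ q))
        ≈⟨ ≋-trans (deriv-⊕ (scale a q) (0# ∷ p ⊗ q)) (⊕-cong (deriv-scale a q) (deriv-∷ 0# (p ⊗ q))) ⟩
      scale a q′ ⊕ ((p ⊗ q) ⊕ (0# ∷ deriv (p ⊗ q)))
        ≈⟨ ⊕-congˡ (scale a q′) (⊕-congˡ (p ⊗ q)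
             (≋-trans (∷-cong refl (deriv-⊗ p q)) (0∷-⊕ (p′ ⊗ q) (p ⊗ q′)))) ⟩
      scale a q′ ⊕ ((p ⊗ q) ⊕ ((0# ∷ p′ ⊗ q) ⊕ (0# ∷ p ⊗ q′)))
        ≈⟨ ⊕-congˡ (scale a q′) (⊕-assoc (p ⊗ q) (0# ∷ p′ ⊗ q) (0# ∷ p ⊗ q′)) ⟨
      scale a q′ ⊕ (((p ⊗ q) ⊕ (0# ∷ p′ ⊗ q)) ⊕ (0# ∷ p ⊗ q′))
        ≈⟨ ⊕-Properties.x∙yz≈y∙xz (scale a q′) ((p ⊗ q) ⊕ (0# ∷ p′ ⊗ q)) (0# ∷ p ⊗ q′) ⟩
      ((p ⊗ q) ⊕ (0# ∷ p′ ⊗ q)) ⊕ ((a ∷ p) ⊗ q′)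
        ≈⟨ ⊕-congʳ ((a ∷ p) ⊗ q′)
             (≋-trans (⊗-distribʳ-⊕ p (0# ∷ p′) q) (⊕-congˡ (p ⊗ q) (0∷-⊗ p′ q))) ⟨
      ((p ⊕ (0# ∷ p′)) ⊗ q) ⊕ ((a ∷ p) ⊗ q′)
        ≈⟨ ⊕-congʳ ((a ∷ p) ⊗ q′) (⊗-congˡ q (deriv-∷ a p)) ⟨
      (deriv (a ∷ p) ⊗ q) ⊕ ((a ∷ p) ⊗ q′) ∎
      where
      p′ = deriv p
      q′ = deriv q

    deriv-monic-linear-⊗ : ∀ c p → deriv (c ∷ 1# ∷ []) ⊗ p ≋ p
    deriv-monic-linear-⊗ c p = ≋-trans (const-⊗ _ p) (≋-trans (scale-congˡ p 1*1≈1) (scale-identity p))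
      where
      1*1≈1 : natR 1 * 1# ≈ 1#
      1*1≈1 = trans (*-identityʳ _) (+-identityʳ 1#)

    deriv-monic-linear-^P : ∀ c m → deriv ((c ∷ 1# ∷ []) ^P suc m) ≋ scale (natR (suc m)) ((c ∷ 1# ∷ []) ^P m)
    deriv-monic-linear-^P c zero = mk≋ λ where
      zero    → *-congˡ (trans (+-identityʳ _) (*-identityʳ 1#))
      (suc i) → refl
    deriv-monic-linear-^P c (suc m) = begin
      deriv (L ⊗ L^m+1)                               ≈⟨ deriv-⊗ L L^m+1 ⟩
      (deriv L ⊗ L^m+1) ⊕ (L ⊗ deriv L^m+1)
        ≈⟨ ⊕-cong (deriv-monic-linear-⊗ c L^m+1) (⊗-congʳ L (deriv-monic-linear-^P c m)) ⟩
      L^m+1 ⊕ (L ⊗ scale (natR (suc m)) (L ^P m))     ≈⟨ ⊕-congˡ L^m+1 (⊗-scaleʳ (natR (suc m)) L (L ^P m)) ⟩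
      L^m+1 ⊕ scale (natR (suc m)) L^m+1              ≈⟨ ⊕-congʳ (scale (natR (suc m)) L^m+1) (scale-identity L^m+1) ⟨
      scale 1# L^m+1 ⊕ scale (natR (suc m)) L^m+1     ≈⟨ scale-distribʳ 1# (natR (suc m)) L^m+1 ⟨
      scale (natR (suc (suc m))) L^m+1                ∎
      where
      L = c ∷ 1# ∷ []
      L^m+1 = L ^P suc m

  module _ where
    open import Relation.Binary.Reasoning.Setoid setoid

    eval-⊗ : ∀ p q z → eval (p ⊗ q) z ≈ eval p z * eval q z
    eval-⊗ []      q z = sym (zeroˡ _)
    eval-⊗ (a ∷ p) q z = begin
      eval (scale a q ⊕ (0# ∷ p ⊗ q)) z                ≈⟨ eval-⊕ (scale a q) (0# ∷ p ⊗ q) z ⟩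
      eval (scale a q) z + (0# + z * eval (p ⊗ q) z)   ≈⟨ +-cong (eval-scale a q z) (+-congˡ (*-congˡ (eval-⊗ p q z))) ⟩
      a * eval q z + (0# + z * (eval p z * eval q z))
        ≈⟨ solve 4 (λ a z x y → a :* y :+ (con 0 :+ z :* (x :* y)) := (a :+ z :* x) :* y) refl a z _ _ ⟩
      (a + z * eval p z) * eval q z                    ∎

    eval-monic-linear : ∀ c z → eval (c ∷ 1# ∷ []) z ≈ c + z
    eval-monic-linear c z = +-congˡ (trans (*-congˡ (trans (+-congˡ (zeroʳ z)) (+-identityʳ 1#))) (*-identityʳ z))

    derivN-cong : ∀ k {p q} → p ≋ q → derivN k p ≋ derivN k q
    derivN-cong zero    p≋q = p≋q
    derivN-cong (suc k) p≋q = deriv-cong (derivN-cong k p≋q)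

    derivN-⊕ : ∀ k p q → derivN k (p ⊕ q) ≋ derivN k p ⊕ derivN k q
    derivN-⊕ zero    p q = ≋-refl
    derivN-⊕ (suc k) p q = ≋-trans (deriv-cong (derivN-⊕ k p q)) (deriv-⊕ (derivN k p) (derivN k q))

    derivN-scale : ∀ k a p → derivN k (scale a p) ≋ scale a (derivN k p)
    derivN-scale zero    a p = ≋-refl
    derivN-scale (suc k) a p = ≋-trans (deriv-cong (derivN-scale k a p)) (deriv-scale a (derivN k p))

    derivN-deriv : ∀ k p → derivN k (deriv p) ≡ derivN (suc k) p
    derivN-deriv zero    p = ≡.refl
    derivN-deriv (suc k) p = ≡.cong deriv (derivN-deriv k p)

    length-derivFrom : ∀ k p → length (derivFrom k p) ≡ length p
    length-derivFrom k []      = ≡.refl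
    length-derivFrom k (a ∷ p) = ≡.cong suc (length-derivFrom (suc k) p)

    length-deriv : ∀ p → length (deriv p) ≡ ℕ.pred (length p)
    length-deriv []      = ≡.refl
    length-deriv (a ∷ p) = length-derivFrom 1 p

    length-derivN : ∀ k p → length (derivN k p) ≡ length p ℕ.∸ k
    length-derivN zero    p = ≡.refl
    length-derivN (suc k) p = ≡.trans (length-deriv (derivN k p))
      (≡.trans (≡.cong ℕ.pred (length-derivN k p)) (ℕ.pred[m∸n]≡m∸[1+n] (length p) k))

    derivN-vanishes : ∀ k p → length p ℕ.≤ k → derivN k p ≡ []
    derivN-vanishes k p len≤k with derivN k p | ≡.trans (length-derivN k p) (ℕ.m≤n⇒m∸n≡0 len≤k)
    ... | [] | _ = ≡.refl

    length-⊕ : ∀ {n} p q → length p ℕ.≤ n → length q ℕ.≤ n → length (p ⊕ q) ℕ.≤ n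
    length-⊕ []      q       _           len-q       = len-q
    length-⊕ (a ∷ p) []      len-p       _           = len-p
    length-⊕ (a ∷ p) (b ∷ q) (ℕ.s≤s len-p) (ℕ.s≤s len-q) = ℕ.s≤s (length-⊕ p q len-p len-q)

    length-scale : ∀ a p → length (scale a p) ≡ length p
    length-scale a []      = ≡.refl
    length-scale a (b ∷ p) = ≡.cong suc (length-scale a p)

    length-⊗ : ∀ p q → length (p ⊗ q) ℕ.≤ length p ℕ.+ ℕ.pred (length q)
    length-⊗ []      q = ℕ.z≤n
    length-⊗ (a ∷ p) q = length-⊕ (scale a q) (0# ∷ p ⊗ q) len-scale (ℕ.s≤s (length-⊗ p q))
      where
      len-scale : length (scale a q) ℕ.≤ suc (length p ℕ.+ ℕ.pred (length q))
      len-scale rewrite length-scale a q = ℕ.≤-trans (ℕ.m≤n+m∸n (length q) 1) (ℕ.s≤s (ℕ.m≤n+m _ (length p)))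

    length-linear-^P : ∀ c d m → length ((c ∷ d ∷ []) ^P m) ℕ.≤ suc m
    length-linear-^P c d zero    = ℕ.≤-refl
    length-linear-^P c d (suc m) =
      ℕ.≤-trans (length-⊗ (c ∷ d ∷ []) ((c ∷ d ∷ []) ^P m))
                (ℕ.s≤s (ℕ.s≤s (ℕ.pred-mono-≤ (length-linear-^P c d m))))

  -- The polynomials f and P

  module _ (α : Carrier) where
    open WithAlpha α

    X Y : Pol
    X = 0# ∷ 1# ∷ []
    Y = - α ∷ 1# ∷ []

    length-f : ∀ m₁ m₂ → length (f m₁ m₂) ℕ.≤ suc (m₁ ℕ.+ m₂)
    length-f m₁ m₂ = ℕ.≤-trans (length-⊗ (X ^P m₁) (Y ^P m₂))
      (ℕ.+-mono-≤ (length-linear-^P 0# 1# m₁) (ℕ.pred-mono-≤ (length-linear-^P (- α) 1# m₂)))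

    module _ where
      open import Relation.Binary.Reasoning.Setoid ≋-setoid

      f-sucˡ : ∀ m₁ m₂ → f (suc m₁) m₂ ≋ X ⊗ f m₁ m₂
      f-sucˡ m₁ m₂ = ⊗-assoc X (X ^P m₁) (Y ^P m₂)

      f-sucʳ : ∀ m₁ m₂ → f m₁ (suc m₂) ≋ Y ⊗ f m₁ m₂
      f-sucʳ m₁ m₂ = begin
        (X ^P m₁) ⊗ (Y ⊗ (Y ^P m₂))  ≈⟨ ⊗-assoc (X ^P m₁) Y (Y ^P m₂) ⟨
        ((X ^P m₁) ⊗ Y) ⊗ (Y ^P m₂)  ≈⟨ ⊗-congˡ (Y ^P m₂) (⊗-comm (X ^P m₁) Y) ⟩
        (Y ⊗ (X ^P m₁)) ⊗ (Y ^P m₂)  ≈⟨ ⊗-assoc Y (X ^P m₁) (Y ^P m₂) ⟩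
        Y ⊗ f m₁ m₂                  ∎

      f-0-1 : f 0 1 ≋ Y
      f-0-1 = ≋-trans (f-sucʳ 0 0) (≋-trans (⊗-congʳ Y (⊗-identityʳ (1# ∷ []))) (⊗-identityʳ Y))

      f-1-0 : f 1 0 ≋ X
      f-1-0 = ≋-trans (f-sucˡ 0 0) (≋-trans (⊗-congʳ X (⊗-identityʳ (1# ∷ []))) (⊗-identityʳ X))

      X≋Y⊕α : X ≋ Y ⊕ (α ∷ [])
      X≋Y⊕α = ∷-cong (sym (-‿inverseˡ α)) ≋-refl

      f-shift : ∀ m₁ m₂ → f (suc m₁) m₂ ≋ f m₁ (suc m₂) ⊕ scale α (f m₁ m₂)
      f-shift m₁ m₂ = begin
        f (suc m₁) m₂                             ≈⟨ f-sucˡ m₁ m₂ ⟩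
        X ⊗ f m₁ m₂                               ≈⟨ ⊗-congˡ (f m₁ m₂) X≋Y⊕α ⟩
        (Y ⊕ (α ∷ [])) ⊗ f m₁ m₂                  ≈⟨ ⊗-distribʳ-⊕ Y (α ∷ []) (f m₁ m₂) ⟩
        (Y ⊗ f m₁ m₂) ⊕ ((α ∷ []) ⊗ f m₁ m₂)      ≈⟨ ⊕-cong (≋-sym (f-sucʳ m₁ m₂)) (const-⊗ α (f m₁ m₂)) ⟩
        f m₁ (suc m₂) ⊕ scale α (f m₁ m₂)         ∎

      deriv-f : ∀ m₁ m₂ → deriv (f (suc m₁) (suc m₂))
                          ≋ scale (natR (suc m₁)) (f m₁ (suc m₂)) ⊕ scale (natR (suc m₂)) (f (suc m₁) m₂)
      deriv-f m₁ m₂ = begin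
        deriv ((X ^P suc m₁) ⊗ (Y ^P suc m₂))
          ≈⟨ deriv-⊗ (X ^P suc m₁) (Y ^P suc m₂) ⟩
        (deriv (X ^P suc m₁) ⊗ (Y ^P suc m₂)) ⊕ ((X ^P suc m₁) ⊗ deriv (Y ^P suc m₂))
          ≈⟨ ⊕-cong (⊗-congˡ (Y ^P suc m₂) (deriv-monic-linear-^P 0# m₁))
                    (⊗-congʳ (X ^P suc m₁) (deriv-monic-linear-^P (- α) m₂)) ⟩
        (scale n₁ (X ^P m₁) ⊗ (Y ^P suc m₂)) ⊕ ((X ^P suc m₁) ⊗ scale n₂ (Y ^P m₂))
          ≈⟨ ⊕-cong (⊗-scaleˡ n₁ (X ^P m₁) (Y ^P suc m₂)) (⊗-scaleʳ n₂ (X ^P suc m₁) (Y ^P m₂)) ⟩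
        scale n₁ (f m₁ (suc m₂)) ⊕ scale n₂ (f (suc m₁) m₂) ∎
        where
        n₁ = natR (suc m₁)
        n₂ = natR (suc m₂)

    open import Relation.Binary.Reasoning.Setoid setoid
    open import Algebra.Properties.Ring ring using (-‿distribˡ-*)
    open import Algebra.Properties.Group +-group using (//-rightDividesʳ)

    sumDerivs-cong : ∀ K {p q} z → p ≋ q → sumDerivs K p z ≈ sumDerivs K q z
    sumDerivs-cong zero    z p≋q = eval-cong z p≋q
    sumDerivs-cong (suc K) z p≋q = +-cong (eval-cong z (derivN-cong (suc K) p≋q)) (sumDerivs-cong K z p≋q)

    sumDerivs-⊕ : ∀ K p q z → sumDerivs K (p ⊕ q) z ≈ sumDerivs K p z + sumDerivs K q z
    sumDerivs-⊕ zero    p q z = eval-⊕ p q z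
    sumDerivs-⊕ (suc K) p q z = begin
      eval (derivN (suc K) (p ⊕ q)) z + sumDerivs K (p ⊕ q) z
        ≈⟨ +-cong (trans (eval-cong z (derivN-⊕ (suc K) p q)) (eval-⊕ (derivN (suc K) p) (derivN (suc K) q) z))
                  (sumDerivs-⊕ K p q z) ⟩
      (eval (derivN (suc K) p) z + eval (derivN (suc K) q) z) + (sumDerivs K p z + sumDerivs K q z)
        ≈⟨ +-Properties.interchange _ _ _ _ ⟩
      (eval (derivN (suc K) p) z + sumDerivs K p z) + (eval (derivN (suc K) q) z + sumDerivs K q z) ∎

    sumDerivs-scale : ∀ K a p z → sumDerivs K (scale a p) z ≈ a * sumDerivs K p z
    sumDerivs-scale zero    a p z = eval-scale a p z
    sumDerivs-scale (suc K) a p z = begin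
      eval (derivN (suc K) (scale a p)) z + sumDerivs K (scale a p) z
        ≈⟨ +-cong (trans (eval-cong z (derivN-scale (suc K) a p)) (eval-scale a (derivN (suc K) p) z))
                  (sumDerivs-scale K a p z) ⟩
      a * eval (derivN (suc K) p) z + a * sumDerivs K p z  ≈⟨ distribˡ a _ _ ⟨
      a * sumDerivs (suc K) p z                            ∎

    sumDerivs-suc : ∀ K p z → sumDerivs (suc K) p z ≈ eval p z + sumDerivs K (deriv p) z
    sumDerivs-suc zero    p z = +-comm _ _
    sumDerivs-suc (suc K) p z = begin
      eval (derivN (suc (suc K)) p) z + sumDerivs (suc K) p z
        ≈⟨ +-congˡ (sumDerivs-suc K p z) ⟩
      eval (derivN (suc (suc K)) p) z + (eval p z + sumDerivs K (deriv p) z)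
        ≈⟨ +-Properties.x∙yz≈y∙xz _ _ _ ⟩
      eval p z + (eval (derivN (suc (suc K)) p) z + sumDerivs K (deriv p) z)
        ≡⟨ ≡.cong (λ r → eval p z + (eval r z + sumDerivs K (deriv p) z)) (derivN-deriv (suc K) p) ⟨
      eval p z + sumDerivs (suc K) (deriv p) z ∎

    sumDerivs-stable : ∀ K p z → length p ℕ.≤ suc K → sumDerivs (suc K) p z ≈ sumDerivs K p z
    sumDerivs-stable K p z len≤ = begin
      eval (derivN (suc K) p) z + sumDerivs K p z
        ≡⟨ ≡.cong (λ r → eval r z + sumDerivs K p z) (derivN-vanishes (suc K) p len≤) ⟩
      0# + sumDerivs K p z  ≈⟨ +-identityˡ _ ⟩
      sumDerivs K p z       ∎

    P-shift : ∀ m₁ m₂ z → P (suc m₁) m₂ z ≈ P m₁ (suc m₂) z + α * P m₁ m₂ z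
    P-shift m₁ m₂ z = begin
      sumDerivs (suc K) (f (suc m₁) m₂) z
        ≈⟨ sumDerivs-cong (suc K) z (f-shift m₁ m₂) ⟩
      sumDerivs (suc K) (f m₁ (suc m₂) ⊕ scale α (f m₁ m₂)) z
        ≈⟨ sumDerivs-⊕ (suc K) (f m₁ (suc m₂)) (scale α (f m₁ m₂)) z ⟩
      sumDerivs (suc K) (f m₁ (suc m₂)) z + sumDerivs (suc K) (scale α (f m₁ m₂)) z
        ≈⟨ +-congˡ (trans (sumDerivs-scale (suc K) α (f m₁ m₂) z)
                          (*-congˡ (sumDerivs-stable K (f m₁ m₂) z (length-f m₁ m₂)))) ⟩
      sumDerivs (suc K) (f m₁ (suc m₂)) z + α * P m₁ m₂ z
        ≡⟨ ≡.cong (λ k → sumDerivs k (f m₁ (suc m₂)) z + α * P m₁ m₂ z) (ℕ.+-suc m₁ m₂) ⟨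
      P m₁ (suc m₂) z + α * P m₁ m₂ z ∎
      where
      K = m₁ ℕ.+ m₂

    IsCommonRoot : Carrier → Set ℓ
    IsCommonRoot z = ∀ m₁ m₂ → eval (f (suc m₁) (suc m₂)) z ≈ 0#

    eval-⊗-vanishˡ : ∀ p q z → eval p z ≈ 0# → eval (p ⊗ q) z ≈ 0#
    eval-⊗-vanishˡ p q z p[z]≈0 = trans (eval-⊗ p q z) (trans (*-congʳ p[z]≈0) (zeroˡ _))

    0-isCommonRoot : IsCommonRoot 0#
    0-isCommonRoot m₁ m₂ = trans (eval-cong 0# (f-sucˡ m₁ (suc m₂)))
      (eval-⊗-vanishˡ X (f m₁ (suc m₂)) 0# (trans (eval-monic-linear 0# 0#) (+-identityˡ 0#)))

    α-isCommonRoot : IsCommonRoot α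
    α-isCommonRoot m₁ m₂ = trans (eval-cong α (f-sucʳ (suc m₁) m₂))
      (eval-⊗-vanishˡ Y (f (suc m₁) m₂) α (trans (eval-monic-linear (- α) α) (-‿inverseˡ α)))

    P-root-recurrence : ∀ {z} → IsCommonRoot z → ∀ m₁ m₂ →
      P (suc m₁) (suc m₂) z ≈ natR (suc m₁) * P m₁ (suc m₂) z + natR (suc m₂) * P (suc m₁) m₂ z
    P-root-recurrence {z} root m₁ m₂ = begin
      sumDerivs (suc K) F z                          ≈⟨ sumDerivs-suc K F z ⟩
      eval F z + sumDerivs K (deriv F) z             ≈⟨ +-cong (root m₁ m₂) (sumDerivs-cong K z (deriv-f m₁ m₂)) ⟩
      0# + sumDerivs K (scale n₁ F₁ ⊕ scale n₂ F₂) z  ≈⟨ +-identityˡ _ ⟩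
      sumDerivs K (scale n₁ F₁ ⊕ scale n₂ F₂) z      ≈⟨ sumDerivs-⊕ K (scale n₁ F₁) (scale n₂ F₂) z ⟩
      sumDerivs K (scale n₁ F₁) z + sumDerivs K (scale n₂ F₂) z
                                                     ≈⟨ +-cong (sumDerivs-scale K n₁ F₁ z) (sumDerivs-scale K n₂ F₂ z) ⟩
      n₁ * sumDerivs K F₁ z + n₂ * sumDerivs K F₂ z
        ≡⟨ ≡.cong (λ k → n₁ * sumDerivs K F₁ z + n₂ * sumDerivs k F₂ z) (ℕ.+-suc m₁ m₂) ⟩
      n₁ * P m₁ (suc m₂) z + n₂ * P (suc m₁) m₂ z    ∎
      where
      K  = m₁ ℕ.+ suc m₂
      F  = f (suc m₁) (suc m₂)
      F₁ = f m₁ (suc m₂)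
      F₂ = f (suc m₁) m₂
      n₁ = natR (suc m₁)
      n₂ = natR (suc m₂)

    -- The matrix recurrence

    module _ {z : Carrier} (root : IsCommonRoot z) (n : ℕ) where
      private
        N = natR (suc n)
        O = natR (2 ℕ.* suc (suc n) ℕ.∸ 1)
        u = P n (suc n) z
        v = P (suc n) n z
        W = P (suc n) (suc n) z

        W≈ : W ≈ N * u + N * v
        W≈ = P-root-recurrence root n n

        O≈ : O ≈ N + (1# + N)
        O≈ = natR-2*-∸1 (suc n)

      A-row₀-step : P (suc n) (suc (suc n)) z ≈ N * ((O - α) * u + O * v)
      A-row₀-step = begin
        P (suc n) (suc (suc n)) z           ≈⟨ P-root-recurrence root n (suc n) ⟩
        N * T + (1# + N) * W                ≈⟨ +-congʳ (*-congˡ T≈) ⟩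
        N * (W + - α * u) + (1# + N) * W    ≈⟨ +-cong (*-congˡ (+-congʳ W≈)) (*-congˡ W≈) ⟩
        N * ((N * u + N * v) + - α * u) + (1# + N) * (N * u + N * v)
          ≈⟨ solve 4 (λ N β u v → N :* ((N :* u :+ N :* v) :+ β :* u) :+ (con 1 :+ N) :* (N :* u :+ N :* v)
                               := N :* ((N :+ (con 1 :+ N) :+ β) :* u :+ (N :+ (con 1 :+ N)) :* v)) refl N (- α) u v ⟩
        N * ((N + (1# + N) + - α) * u + (N + (1# + N)) * v)
          ≈⟨ *-congˡ (+-cong (*-congʳ (+-congʳ O≈)) (*-congʳ O≈)) ⟨
        N * ((O - α) * u + O * v)           ∎
        where
        T = P n (suc (suc n)) z

        T≈ : T ≈ W + - α * u
        T≈ = begin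
          T                    ≈⟨ //-rightDividesʳ (α * u) T ⟨
          (T + α * u) - α * u  ≈⟨ +-congʳ (P-shift n (suc n) z) ⟨
          W - α * u            ≈⟨ +-congˡ (-‿distribˡ-* α u) ⟩
          W + - α * u          ∎

      A-row₁-step : P (suc (suc n)) (suc n) z ≈ N * (O * u + (O + α) * v)
      A-row₁-step = begin
        P (suc (suc n)) (suc n) z               ≈⟨ P-root-recurrence root (suc n) n ⟩
        (1# + N) * W + N * P (suc (suc n)) n z  ≈⟨ +-congˡ (*-congˡ (P-shift (suc n) n z)) ⟩
        (1# + N) * W + N * (W + α * v)          ≈⟨ +-cong (*-congˡ W≈) (*-congˡ (+-congʳ W≈)) ⟩
        (1# + N) * (N * u + N * v) + N * ((N * u + N * v) + α * v)
          ≈⟨ solve 4 (λ N a u v → (con 1 :+ N) :* (N :* u :+ N :* v) :+ N :* ((N :* u :+ N :* v) :+ a :* v)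
                               := N :* ((N :+ (con 1 :+ N)) :* u :+ (N :+ (con 1 :+ N) :+ a) :* v)) refl N α u v ⟩
        N * ((N + (1# + N)) * u + (N + (1# + N) + α) * v)
          ≈⟨ *-congˡ (+-cong (*-congʳ O≈) (*-congʳ (+-congʳ O≈))) ⟨
        N * (O * u + (O + α) * v)               ∎

    A-step : ∀ n i j → A (suc (suc n)) (suc (suc n)) i j
                       ≈ natR (suc n) * (C (suc (suc n)) ⊛ A (suc n) (suc n)) i j
    A-step n zero       zero       = A-row₀-step 0-isCommonRoot n
    A-step n zero       (suc zero) = A-row₀-step α-isCommonRoot n
    A-step n (suc zero) zero       = A-row₁-step 0-isCommonRoot n
    A-step n (suc zero) (suc zero) = A-row₁-step α-isCommonRoot n

    P-monic-linear : ∀ c z → sumDerivs 1 (c ∷ 1# ∷ []) z ≈ natR 1 + (c + z)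
    P-monic-linear = solve 2 (λ c z → ((con 1 :+ con 0) :* con 1 :+ z :* con 0) :+ (c :+ z :* (con 1 :+ z :* con 0))
                                   := (con 1 :+ con 0) :+ (c :+ z)) refl

    P-0-1 : ∀ z → P 0 1 z ≈ natR 1 + (- α + z)
    P-0-1 z = trans (sumDerivs-cong 1 z f-0-1) (P-monic-linear (- α) z)

    P-1-0 : ∀ z → P 1 0 z ≈ natR 1 + (0# + z)
    P-1-0 z = trans (sumDerivs-cong 1 z f-1-0) (P-monic-linear 0# z)

    A-base : ∀ i j → A 1 1 i j ≈ C 1 i j
    A-base zero       zero       = trans (P-0-1 0#) (+-congˡ (+-identityʳ (- α)))
    A-base zero       (suc zero) = trans (P-0-1 α) (trans (+-congˡ (-‿inverseˡ α)) (+-identityʳ _))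
    A-base (suc zero) zero       = trans (P-1-0 0#) (trans (+-congˡ (+-identityˡ 0#)) (+-identityʳ _))
    A-base (suc zero) (suc zero) = trans (P-1-0 α) (+-congˡ (+-identityˡ α))

    ⊛-identityʳ : ∀ (M : Mat) i j → (M ⊛ I₂) i j ≈ M i j
    ⊛-identityʳ M i zero       = solve 2 (λ x y → x :* con 1 :+ y :* con 0 := x) refl _ _
    ⊛-identityʳ M i (suc zero) = solve 2 (λ x y → x :* con 0 :+ y :* con 1 := y) refl _ _

    ⊛-*ʳ : ∀ (M : Mat) {M₁ M₂ : Mat} k → (∀ i j → M₁ i j ≈ k * M₂ i j) →
           ∀ i j → (M ⊛ M₁) i j ≈ k * (M ⊛ M₂) i j
    ⊛-*ʳ M {M₁} {M₂} k M₁≈kM₂ i j = begin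
      M i zero * M₁ zero j + M i (suc zero) * M₁ (suc zero) j
        ≈⟨ +-cong (*-congˡ (M₁≈kM₂ zero j)) (*-congˡ (M₁≈kM₂ (suc zero) j)) ⟩
      M i zero * (k * M₂ zero j) + M i (suc zero) * (k * M₂ (suc zero) j)
        ≈⟨ solve 5 (λ a b k x y → a :* (k :* x) :+ b :* (k :* y) := k :* (a :* x :+ b :* y)) refl _ _ k _ _ ⟩
      k * (M i zero * M₂ zero j + M i (suc zero) * M₂ (suc zero) j) ∎

    A-factorisation : ∀ n i j → A (suc n) (suc n) i j ≈ natR (n !) * prodC (suc n) i j
    A-factorisation zero    i j = begin
      A 1 1 i j                ≈⟨ A-base i j ⟩
      C 1 i j                  ≈⟨ ⊛-identityʳ (C 1) i j ⟨
      prodC 1 i j              ≈⟨ trans (*-congʳ (+-identityʳ 1#)) (*-identityˡ _) ⟨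
      natR 1 * prodC 1 i j     ∎
    A-factorisation (suc n) i j = begin
      A (suc (suc n)) (suc (suc n)) i j
        ≈⟨ A-step n i j ⟩
      natR (suc n) * (C (suc (suc n)) ⊛ A (suc n) (suc n)) i j
        ≈⟨ *-congˡ (⊛-*ʳ (C (suc (suc n))) (natR (n !)) (A-factorisation n) i j) ⟩
      natR (suc n) * (natR (n !) * prodC (suc (suc n)) i j)
        ≈⟨ *-assoc _ _ _ ⟨
      natR (suc n) * natR (n !) * prodC (suc (suc n)) i j
        ≈⟨ *-congʳ (natR-* (suc n) (n !)) ⟨
      natR (suc n !) * prodC (suc (suc n)) i j ∎

mainTheorem18 : ∀ {c ℓ : Level} (R : CommutativeRing c ℓ) (α : CommutativeRing.Carrier R) →
    ¬ (CommutativeRing._≈_ R α (CommutativeRing.0# R)) →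
    (n : ℕ) → (i j : Fin 2) →
    CommutativeRing._≈_ R
      (Poly.WithAlpha.A R α (suc n) (suc n) i j)
      (CommutativeRing._*_ R (Poly.natR R (n !)) (Poly.WithAlpha.prodC R α (suc n) i j))
mainTheorem18 R α _ = A-factorisation R α
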